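{- In any execution of Algorithm A, if $id\in$ accepted$_p$ (at the end of Step 4) for some correct process $p$, then at least $N-2t$ correct processes received $id$ in an ID message in Step 1.
   Context: System model: $N$ processes in a fully connected synchronous message-passing network with reliable channels; a receiver knows the label of the link on which a message arrived but not the sender's identifier; each correct process has a unique identifier initially known only to itself; up to $t$ processes are Byzantine (arbitrary behavior); throughout, $N>3t$. "Broadcast" means send to all $N$ links (including a self-loop). Id selection phase of Algorithm A (each correct process). Step 1: broadcast $\langle ID, my\_id\rangle$; Ids $:=$ set of identifiers received in ID messages. Step 2: for each $id\in$ Ids broadcast $\langle ECHO,id\rangle$; reset Ids to the set of $id$ for which $\langle ECHO,id\rangle$ was received on at least $N-t$ distinct links. Step 3: for each $id\in$ Ids broadcast $\langle READY,id\rangle$; timely $:=$ set of $id$ for which $\langle READY,id\rangle$ was received on at least $N-t$ distinct links; reset Ids to the set of $id$ for which $\langle READY,id\rangle$ was received on at least $N-2t$ distinct links and for which the process has not broadcast $\langle READY,id\rangle$. Step 4: for each $id\in$ Ids broadcast $\langle READY,id\rangle$; accepted $:=$ set of $id$ for which $\langle READY,id\rangle$ messages (Steps 3 and 4 together) were received on at least $N-t$ distinct links. -}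

module Defs where

open import Data.Nat.Base using (ℕ; zero; suc; _+_; _∸_; _≤_; _≤ᵇ_; _≡ᵇ_)
open import Data.Bool.Base using (Bool; true; false; if_then_else_; _∧_; _∨_; not)
open import Data.Fin.Base using (Fin; zero; suc)
open import Relation.Binary.PropositionalEquality using (_≡_)

count : ∀ {n} → (Fin n → Bool) → ℕ
count {zero}  f = 0
count {suc n} f = (if f zero then 1 else 0) + count (λ i → f (suc i))

anyF : ∀ {n} → (Fin n → Bool) → Bool
anyF {zero}  f = false
anyF {suc n} f = f zero ∨ anyF (λ i → f (suc i))

Ident : Set
Ident = ℕ

-- A message matrix for one step: msg q p id = true iff process q sent,
-- in this step, a message carrying identifier id on its link to p.
-- (Links are in bijection with senders, so counting distinct links on
-- which something was received = counting distinct senders.)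
Msgs : ℕ → Set
Msgs N = Fin N → Fin N → Ident → Bool

module _ (N t : ℕ) where

  ids₁ : Msgs N → Fin N → Ident → Bool
  ids₁ idM p id = anyF (λ q → idM q p id)

  ids₂ : Msgs N → Fin N → Ident → Bool
  ids₂ echoM p id = (N ∸ t) ≤ᵇ count (λ q → echoM q p id)

  -- Step 3: Ids of p = ids whose READY was received on ≥ N-2t links and
  -- for which p has not broadcast READY (in step 3, i.e. id ∉ ids₂).
  ids₃ : Msgs N → Msgs N → Fin N → Ident → Bool
  ids₃ echoM ready3M p id =
    ((N ∸ (t + t)) ≤ᵇ count (λ q → ready3M q p id)) ∧ not (ids₂ echoM p id)

  accepted : Msgs N → Msgs N → Fin N → Ident → Bool
  accepted ready3M ready4M p id =
    (N ∸ t) ≤ᵇ count (λ q → ready3M q p id ∨ ready4M q p id)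

-- An execution of the id selection phase of Algorithm A.
-- Byzantine processes (correct = false) send arbitrary messages;
-- correct processes follow the algorithm (broadcasting to all links).
record Execution (N t : ℕ) : Set where
  field
    correct    : Fin N → Bool
    faulty≤t   : count (λ q → not (correct q)) ≤ t
    myId       : Fin N → Ident
    idsUnique  : ∀ p q → correct p ≡ true → correct q ≡ true →
                 myId p ≡ myId q → p ≡ q
    idMsg      : Msgs N
    echoMsg    : Msgs N
    ready3Msg  : Msgs N
    ready4Msg  : Msgs N
    idCorrect     : ∀ q p id → correct q ≡ true →
                    idMsg q p id ≡ (myId q ≡ᵇ id)
    echoCorrect   : ∀ q p id → correct q ≡ true →
                    echoMsg q p id ≡ ids₁ N t idMsg q id
    ready3Correct : ∀ q p id → correct q ≡ true →
                    ready3Msg q p id ≡ ids₂ N t echoMsg q id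
    ready4Correct : ∀ q p id → correct q ≡ true →
                    ready4Msg q p id ≡ ids₃ N t echoMsg ready3Msg q id

module Submission where

-- The argument traces an accepted identifier back through the steps.
-- Since at most t processes are faulty, any set of more than t senders
-- contains a correct one, and a set of k senders contains at least k - t
-- correct ones (`correct-count`, `correct-witness`).  Using N > 3t:
--   * p accepted id, so READY(id) arrived from N - t > t links, hence some
--     correct q broadcast READY(id) in Step 3 or Step 4;
--   * if in Step 4, q received READY(id) in Step 3 on N - 2t > t links, so
--     some correct r broadcast READY(id) in Step 3 (`ready-origin`);
--   * a correct process broadcasting READY(id) in Step 3 received
--     ECHO(id) on N - t links, of which at least N - 2t come from correct
--     processes, each of which received id in Step 1 (`echo-quorum`).

open import Defs
open import Data.Nat.Base using (ℕ; zero; suc; _*_; _∸_; _<_; _+_; _≤_; z≤n; s≤s; _≤ᵇ_)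
open import Data.Nat.Properties
  using (≤ᵇ⇒≤; ≤-trans; <-≤-trans; n≤1+n; +-suc; +-identityʳ; +-monoˡ-≤;
         ∸-monoˡ-≤; ∸-monoʳ-≤; ∸-+-assoc; m≤m+n; m≤n+o⇒m∸n≤o; m+n≤o⇒m≤o∸n;
         m<n⇒0<n∸m)
open import Data.Bool.Base using (Bool; true; false; _∧_; _∨_; not; T)
open import Data.Bool.Properties using (∧-conicalˡ; ∧-conicalʳ)
open import Data.Fin.Base using (Fin; zero; suc)
open import Data.Product using (Σ-syntax; _×_; _,_)
open import Data.Sum using (_⊎_; inj₁; inj₂)
open import Relation.Binary.PropositionalEquality
  using (_≡_; refl; sym; trans; subst; cong)

≤ᵇ-sound : ∀ {m n} → (m ≤ᵇ n) ≡ true → m ≤ n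
≤ᵇ-sound {m} {n} eq = ≤ᵇ⇒≤ m n (subst T (sym eq) _)

∨-true : ∀ {a b} → a ∨ b ≡ true → a ≡ true ⊎ b ≡ true
∨-true {true}  _  = inj₁ refl
∨-true {false} eq = inj₂ eq

count-mono : ∀ {n} (f g : Fin n → Bool) →
             (∀ i → f i ≡ true → g i ≡ true) → count f ≤ count g
count-mono {zero}  f g f⇒g = z≤n
count-mono {suc n} f g f⇒g
  with f zero in ef | g zero in eg
     | count-mono (λ i → f (suc i)) (λ i → g (suc i)) (λ i → f⇒g (suc i))
... | true  | true  | ih = s≤s ih
... | true  | false | ih with () ← trans (sym (f⇒g zero ef)) eg
... | false | true  | ih = ≤-trans ih (n≤1+n _)
... | false | false | ih = ih

count-split : ∀ {n} (c g : Fin n → Bool) →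
              count g ≤ count (λ i → not (c i)) + count (λ i → c i ∧ g i)
count-split {zero}  c g = z≤n
count-split {suc n} c g
  with c zero | g zero | count-split (λ i → c (suc i)) (λ i → g (suc i))
... | true  | true  | ih =
  subst (suc (count (λ i → g (suc i))) ≤_) (sym (+-suc _ _)) (s≤s ih)
... | true  | false | ih = ih
... | false | true  | ih = s≤s ih
... | false | false | ih = ≤-trans ih (n≤1+n _)

count-witness : ∀ {n} (f : Fin n → Bool) → 0 < count f → Σ[ i ∈ Fin n ] f i ≡ true
count-witness {zero}  f ()
count-witness {suc n} f pos with f zero in ef
... | true  = zero , ef
... | false with count-witness (λ i → f (suc i)) pos
...   | i , fi = suc i , fi

-- The two consequences of N > 3t used by the protocol: both the Step 3
-- threshold N - 2t and the Step 4 threshold N - t exceed t.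
module Resilience {N t : ℕ} (N>3t : 3 * t < N) where

  t<N∸2t : t < N ∸ (t + t)
  t<N∸2t = m+n≤o⇒m≤o∸n (suc t) (subst (λ k → suc k ≤ N) 3t≡t+2t N>3t)
    where
    3t≡t+2t : 3 * t ≡ t + (t + t)
    3t≡t+2t = cong (λ k → t + (t + k)) (+-identityʳ t)

  t<N∸t : t < N ∸ t
  t<N∸t = <-≤-trans t<N∸2t (∸-monoʳ-≤ N (m≤m+n t t))

module _ {N t : ℕ} (E : Execution N t) where
  open Execution E

  correct-count : (g : Fin N → Bool) → count g ∸ t ≤ count (λ r → correct r ∧ g r)
  correct-count g = m≤n+o⇒m∸n≤o (count g) t
    (≤-trans (count-split correct g) (+-monoˡ-≤ _ faulty≤t))

  correct-witness : (g : Fin N → Bool) → t < count g →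
                    Σ[ r ∈ Fin N ] correct r ≡ true × g r ≡ true
  correct-witness g t<g
    with count-witness (λ r → correct r ∧ g r)
           (<-≤-trans (m<n⇒0<n∸m t<g) (correct-count g))
  ... | r , cg = r , ∧-conicalˡ _ _ cg , ∧-conicalʳ _ _ cg

  -- A correct process that sends READY(id) in Step 3 received ECHO(id) on
  -- N - t links; the correct senders among them (at least N - 2t) echoed
  -- id, i.e. received id in an ID message in Step 1.
  echo-quorum : ∀ q id → correct q ≡ true → ids₂ N t echoMsg q id ≡ true →
                N ∸ (t + t) ≤ count (λ r → correct r ∧ ids₁ N t idMsg r id)
  echo-quorum q id cq echoed =
    subst (_≤ count (λ r → correct r ∧ ids₁ N t idMsg r id)) (∸-+-assoc N t t)
      (≤-trans (∸-monoˡ-≤ t (≤ᵇ-sound echoed))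
      (≤-trans (correct-count (λ r → echoMsg r q id))
               (count-mono _ _ echo⇒id)))
    where
    echo⇒id : ∀ r → correct r ∧ echoMsg r q id ≡ true →
              correct r ∧ ids₁ N t idMsg r id ≡ true
    echo⇒id r h = subst (λ b → correct r ∧ b ≡ true)
                        (echoCorrect r q id (∧-conicalˡ _ _ h)) h

  ready-origin : t < N ∸ (t + t) → ∀ p id →
                 t < count (λ q → ready3Msg q p id ∨ ready4Msg q p id) →
                 Σ[ r ∈ Fin N ] correct r ≡ true × ids₂ N t echoMsg r id ≡ true
  ready-origin t<N∸2t p id many with correct-witness _ many
  ... | q , cq , sent with ∨-true sent
  ...   | inj₁ sent₃ = q , cq , trans (sym (ready3Correct q p id cq)) sent₃
  ...   | inj₂ sent₄ with correct-witness (λ r → ready3Msg r q id) t<ready₃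
    where
    -- q relayed READY(id) in Step 4, so it saw N - 2t > t Step 3 READYs.
    t<ready₃ : t < count (λ r → ready3Msg r q id)
    t<ready₃ = <-≤-trans t<N∸2t (≤ᵇ-sound (∧-conicalˡ _ _
                 (trans (sym (ready4Correct q p id cq)) sent₄)))
  ...     | r , cr , sent₃ = r , cr , trans (sym (ready3Correct r q id cr)) sent₃

lemma12 : ∀ (N t : ℕ) → 3 * t < N → (E : Execution N t) →
    ∀ (p : Fin N) (id : Ident) →
    Execution.correct E p ≡ true →
    accepted N t (Execution.ready3Msg E) (Execution.ready4Msg E) p id ≡ true →
    N ∸ (t + t) ≤ count (λ r → Execution.correct E r ∧ ids₁ N t (Execution.idMsg E) r id)
lemma12 N t N>3t E p id _ acc
  with ready-origin E t<N∸2t p id (<-≤-trans t<N∸t (≤ᵇ-sound acc))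
  where open Resilience {N} {t} N>3t
... | r , cr , echoed = echo-quorum E r id cr echoed
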